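{- Let $\delta>0$, let $k\ge1$ be an integer, and let $\nu>0$. Then there exists $c_{\mathrm{TV}}(\delta,\nu,k)>0$ such that the following holds. If $s$ is a positive integer and $\mathcal{A}_1,\dots,\mathcal{A}_s$ are non-empty subsets of $\{0,1\}^n$ with density at least $\delta$ inside $\{0,1\}^n$, there exists a positive integer $N(\nu,k)$ such that for all $n\ge N(\nu,k)$ there exists a subset $S\subset[s]$ with $|S|\ge s/(n+1)^{c_{\mathrm{TV}}(\delta,\nu,k)}$ such that \[\mathrm{Diam}_{\mathcal{A}_i:\, i\in S}\, g\le \nu\] for every function $g$ defined on $\{0,1\}^n$ and determined by at most $k$ coordinates.
   Context: The density of $\mathcal{A}\subset\{0,1\}^n$ is $|\mathcal{A}|/2^n$. For distributions $X,Y$ on a finite set $D$, $\mathrm{TV}(X,Y)=\sum_{d\in D}|\mathbb{P}(X=d)-\mathbb{P}(Y=d)|$, and for distributions $X_1,\dots,X_m$ on $D$, $\mathrm{Diam}(X_1,\dots,X_m)=\max_{i<j}\mathrm{TV}(X_i,X_j)$. For a function $g$ on $\{0,1\}^n$ (with finite codomain) and a family of non-empty sets $(\mathcal{A}_i)_{i\in S}$, $\mathrm{Diam}_{\mathcal{A}_i:i\in S}(g)$ is the diameter of the family of distributions of $g(x)$, $x$ uniform in $\mathcal{A}_i$, $i\in S$. -}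

module Defs where

open import Data.Bool using (Bool; true; false; if_then_else_)
open import Data.Nat using (ℕ; zero; suc)
import Data.Nat as ℕ
open import Data.Fin using (Fin)
import Data.Fin as Fin
open import Data.Fin.Subset using (Subset; _∈_)
open import Data.Vec using (Vec; []; _∷_; lookup)
open import Data.List using (List; []; _∷_; map; _++_; foldr; allFin)
open import Data.Nat.ListAction using (sum)
open import Data.Integer using (+_)
open import Data.Rational using (ℚ; 0ℚ; _/_; _-_; ∣_∣; _+_)
open import Relation.Nullary.Decidable using (⌊_⌋)
open import Relation.Binary.PropositionalEquality using (_≡_)

Cube : ℕ → Set
Cube n = Vec Bool n

cube : (n : ℕ) → List (Cube n)
cube zero = [] ∷ []
cube (suc n) = map (true ∷_) (cube n) ++ map (false ∷_) (cube n)

SubsetCube : ℕ → Set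
SubsetCube n = Cube n → Bool

card : {n : ℕ} → SubsetCube n → ℕ
card {n} A = sum (map (λ x → if A x then 1 else 0) (cube n))

cardFiber : {n m : ℕ} → SubsetCube n → (Cube n → Fin m) → Fin m → ℕ
cardFiber {n} A g d =
  sum (map (λ x → if A x then (if ⌊ g x Fin.≟ d ⌋ then 1 else 0) else 0) (cube n))

-- ratio a / b in ℚ (b = 0 never occurs for non-empty sets; set to 0 then)
ratio : ℕ → ℕ → ℚ
ratio a zero = 0ℚ
ratio a (suc b) = (+ a) / suc b

prob : {n m : ℕ} → SubsetCube n → (Cube n → Fin m) → Fin m → ℚ
prob A g d = ratio (cardFiber A g d) (card A)

-- TV(X,Y) = Σ_d |P(X=d) - P(Y=d)|  (no factor 1/2, as in the paper)
TV : {n m : ℕ} → (Cube n → Fin m) → SubsetCube n → SubsetCube n → ℚ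
TV {m = m} g A B = foldr _+_ 0ℚ (map (λ d → ∣ prob A g d - prob B g d ∣) (allFin m))

DeterminedBy : {n : ℕ} {D : Set} → Subset n → (Cube n → D) → Set
DeterminedBy {n} J g =
  ∀ (x y : Cube n) → (∀ (i : Fin n) → i ∈ J → lookup x i ≡ lookup y i) → g x ≡ g y

toℚ : ℕ → ℚ
toℚ a = (+ a) / 1

{-# OPTIONS --safe #-}
-- For A ⊆ {0,1}ⁿ write Â(T) = ∑_{x ∈ A} (-1)^|x ∩ T| for its unnormalised Walsh coefficients.
-- Parseval, ∑_T Â(T)² = 2ⁿ |A|, shows that a set of density at least δ has at most Q²/δ
-- coefficients with |Â(T)| > |A|/Q. The profile of A lists those with |T| ≤ k, each together
-- with the bucket of Â(T)/|A| ∈ [-1, 1] at resolution 2/Q. There are at most (n+1)^c profiles,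
-- so by pigeonhole at least s/(n+1)^c of the sets share a profile, and any two of them have all
-- normalised coefficients of degree at most k within 2/Q of each other. If g only depends on the
-- coordinates in J, |J| ≤ k, then Plancherel against the indicators of the fibres of g bounds the
-- total variation distance by ∑_{T ⊆ J} of these differences, at most 2^k · 2/Q; this is below ν
-- for Q = 2^(k+1) b, where b is the denominator of ν.

module Submission where

open import Defs
open import Algebra.Bundles using (CommutativeSemiring; CommutativeRing)
open import Data.Nat using (ℕ; zero; suc)
open import Data.Bool using (Bool; true; false; if_then_else_)
open import Data.List using (List; []; _∷_; _++_; map; foldr; length)
open import Data.Vec using ([]; _∷_)
open import Function using (_∘_)
open import Relation.Binary.Definitions using (DecidableEquality)
open import Relation.Binary.PropositionalEquality as ≡ using (_≡_)

module Summation {c ℓ} (R : CommutativeSemiring c ℓ) where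

  open CommutativeSemiring R
  open import Algebra.Properties.CommutativeSemigroup +-commutativeSemigroup using (interchange)
  open import Relation.Binary.Reasoning.Setoid setoid

  -- In this form card and TV of Defs are instances of ∑ by definition.
  ∑ : ∀ {a} {A : Set a} → (A → Carrier) → List A → Carrier
  ∑ f xs = foldr _+_ 0# (map f xs)

  module _ {a} {A : Set a} where

    ∑-++ : (f : A → Carrier) (xs ys : List A) → ∑ f (xs ++ ys) ≈ ∑ f xs + ∑ f ys
    ∑-++ f [] ys = sym (+-identityˡ _)
    ∑-++ f (x ∷ xs) ys = begin
      f x + ∑ f (xs ++ ys)       ≈⟨ +-congˡ (∑-++ f xs ys) ⟩
      f x + (∑ f xs + ∑ f ys)    ≈⟨ sym (+-assoc _ _ _) ⟩
      f x + ∑ f xs + ∑ f ys      ∎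

    ∑-cong : {f g : A → Carrier} → (∀ x → f x ≈ g x) → (xs : List A) → ∑ f xs ≈ ∑ g xs
    ∑-cong f≈g [] = refl
    ∑-cong f≈g (x ∷ xs) = +-cong (f≈g x) (∑-cong f≈g xs)

    ∑-zero : {f : A → Carrier} → (∀ x → f x ≈ 0#) → (xs : List A) → ∑ f xs ≈ 0#
    ∑-zero f≈0 [] = refl
    ∑-zero f≈0 (x ∷ xs) = trans (+-cong (f≈0 x) (∑-zero f≈0 xs)) (+-identityˡ 0#)

    ∑-distrib-+ : (f g : A → Carrier) (xs : List A) → ∑ (λ x → f x + g x) xs ≈ ∑ f xs + ∑ g xs
    ∑-distrib-+ f g [] = sym (+-identityˡ 0#)
    ∑-distrib-+ f g (x ∷ xs) = trans (+-congˡ (∑-distrib-+ f g xs)) (interchange _ _ _ _)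

    *-distribˡ-∑ : (u : Carrier) (f : A → Carrier) (xs : List A) → u * ∑ f xs ≈ ∑ (λ x → u * f x) xs
    *-distribˡ-∑ u f [] = zeroʳ u
    *-distribˡ-∑ u f (x ∷ xs) = trans (distribˡ u (f x) (∑ f xs)) (+-congˡ (*-distribˡ-∑ u f xs))

  module _ {a b} {A : Set a} {B : Set b} where

    ∑-map : (f : B → Carrier) (g : A → B) (xs : List A) → ∑ f (map g xs) ≡ ∑ (f ∘ g) xs
    ∑-map f g [] = ≡.refl
    ∑-map f g (x ∷ xs) = ≡.cong (f (g x) +_) (∑-map f g xs)

    ∑-comm : (f : A → B → Carrier) (xs : List A) (ys : List B) →
      ∑ (λ x → ∑ (f x) ys) xs ≈ ∑ (λ y → ∑ (λ x → f x y) xs) ys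
    ∑-comm f [] ys = sym (∑-zero (λ _ → refl) ys)
    ∑-comm f (x ∷ xs) ys = begin
      ∑ (f x) ys + ∑ (λ x → ∑ (f x) ys) xs              ≈⟨ +-congˡ (∑-comm f xs ys) ⟩
      ∑ (f x) ys + ∑ (λ y → ∑ (λ x → f x y) xs) ys      ≈⟨ sym (∑-distrib-+ _ _ ys) ⟩
      ∑ (λ y → f x y + ∑ (λ x → f x y) xs) ys           ∎

  ∑-cube-suc : ∀ {n} (f : Cube (suc n) → Carrier) →
    ∑ f (cube (suc n)) ≈ ∑ (f ∘ (true ∷_)) (cube n) + ∑ (f ∘ (false ∷_)) (cube n)
  ∑-cube-suc {n} f = begin
    ∑ f (map (true ∷_) (cube n) ++ map (false ∷_) (cube n))
      ≈⟨ ∑-++ f (map (true ∷_) (cube n)) (map (false ∷_) (cube n)) ⟩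
    ∑ f (map (true ∷_) (cube n)) + ∑ f (map (false ∷_) (cube n))
      ≡⟨ ≡.cong₂ _+_ (∑-map f (true ∷_) (cube n)) (∑-map f (false ∷_) (cube n)) ⟩
    ∑ (f ∘ (true ∷_)) (cube n) + ∑ (f ∘ (false ∷_)) (cube n) ∎

module ℕSum where

  open import Data.Nat using (_+_; _*_; _^_; _≤_; z≤n)
  open import Data.Nat.Properties
  open import Data.Fin as Fin using (Fin)
  open import Data.List using (filter; allFin)
  open import Data.List.Properties using (length-++; length-map; map-tabulate)
  open import Data.List.Relation.Unary.All using (All; []; _∷_)
  open import Relation.Nullary using (yes; no)
  open import Relation.Unary using (Pred; Decidable)
  open ≡ using (cong; cong₂)

  open Summation +-*-commutativeSemiring public

  module _ {a} {A : Set a} where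

    ∑-mono-≤ : {f g : A → ℕ} → (∀ x → f x ≤ g x) → (xs : List A) → ∑ f xs ≤ ∑ g xs
    ∑-mono-≤ f≤g [] = z≤n
    ∑-mono-≤ f≤g (x ∷ xs) = +-mono-≤ (f≤g x) (∑-mono-≤ f≤g xs)

    ∑-const : (v : ℕ) (xs : List A) → ∑ (λ _ → v) xs ≡ length xs * v
    ∑-const v [] = ≡.refl
    ∑-const v (x ∷ xs) = cong (v +_) (∑-const v xs)

    ∑≤length*bound : {f : A → ℕ} {v : ℕ} {xs : List A} → All (λ x → f x ≤ v) xs → ∑ f xs ≤ length xs * v
    ∑≤length*bound [] = z≤n
    ∑≤length*bound (fx≤v ∷ fxs≤v) = +-mono-≤ fx≤v (∑≤length*bound fxs≤v)

    module _ {p} {P : Pred A p} (P? : Decidable P) where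

      length-filter*≤∑ : (f : A → ℕ) (v : ℕ) → (∀ x → P x → v ≤ f x) → (xs : List A) →
        length (filter P? xs) * v ≤ ∑ f xs
      length-filter*≤∑ f v P⇒v≤f [] = z≤n
      length-filter*≤∑ f v P⇒v≤f (x ∷ xs) with P? x
      ... | yes Px = +-mono-≤ (P⇒v≤f x Px) (length-filter*≤∑ f v P⇒v≤f xs)
      ... | no _ = ≤-trans (length-filter*≤∑ f v P⇒v≤f xs) (m≤n+m _ (f x))

  ∑-allFin-suc : ∀ {m} (f : Fin (suc m) → ℕ) → ∑ f (allFin (suc m)) ≡ f Fin.zero + ∑ (f ∘ Fin.suc) (allFin m)
  ∑-allFin-suc {m} f = cong (f Fin.zero +_)
    (≡.trans (cong (∑ f) (≡.sym (map-tabulate (λ i → i) Fin.suc))) (∑-map f Fin.suc (allFin m)))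

  length-cube : ∀ n → length (cube n) ≡ 2 ^ n
  length-cube zero = ≡.refl
  length-cube (suc n) = begin
    length (map (true ∷_) (cube n) ++ map (false ∷_) (cube n))
      ≡⟨ length-++ (map (true ∷_) (cube n)) ⟩
    length (map (true ∷_) (cube n)) + length (map (false ∷_) (cube n))
      ≡⟨ cong₂ _+_ (length-map (true ∷_) (cube n)) (length-map (false ∷_) (cube n)) ⟩
    length (cube n) + length (cube n)
      ≡⟨ cong₂ _+_ (length-cube n) (≡.trans (length-cube n) (≡.sym (+-identityʳ _))) ⟩
    2 ^ suc n ∎
    where open ≡.≡-Reasoning

module ℤSum where

  open import Data.Integer using (ℤ; +_; -_; _+_; _-_; ∣_∣)
  open import Data.Integer.Properties
  import Data.Nat as ℕ
  import Data.Nat.Properties as ℕP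
  open ≡ using (cong)

  open Summation +-*-commutativeSemiring public

  module _ {a} {A : Set a} where

    ∑-neg : (f : A → ℤ) (xs : List A) → ∑ (λ x → - f x) xs ≡ - ∑ f xs
    ∑-neg f [] = ≡.refl
    ∑-neg f (x ∷ xs) = ≡.trans (cong (λ z → - f x + z) (∑-neg f xs)) (≡.sym (neg-distrib-+ (f x) (∑ f xs)))

    ∑-distrib-- : (f g : A → ℤ) (xs : List A) → ∑ (λ x → f x - g x) xs ≡ ∑ f xs - ∑ g xs
    ∑-distrib-- f g xs = ≡.trans (∑-distrib-+ f (λ x → - g x) xs) (cong (λ z → ∑ f xs + z) (∑-neg g xs))

    ∣∑∣≤∑∣∣ : (f : A → ℤ) (xs : List A) → ∣ ∑ f xs ∣ ℕ.≤ ℕSum.∑ (λ x → ∣ f x ∣) xs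
    ∣∑∣≤∑∣∣ f [] = ℕ.z≤n
    ∣∑∣≤∑∣∣ f (x ∷ xs) = ℕP.≤-trans (∣i+j∣≤∣i∣+∣j∣ (f x) (∑ f xs)) (ℕP.+-monoʳ-≤ ∣ f x ∣ (∣∑∣≤∑∣∣ f xs))

    +-∑ : (f : A → ℕ) (xs : List A) → + ℕSum.∑ f xs ≡ ∑ (λ x → + f x) xs
    +-∑ f [] = ≡.refl
    +-∑ f (x ∷ xs) = ≡.trans (pos-+ (f x) (ℕSum.∑ f xs)) (cong (λ z → + f x + z) (+-∑ f xs))

module Enumeration where

  open import Data.Nat using (_+_; _*_; _^_; _≤_; s≤s)
  open import Data.Nat.Properties
  open import Data.List using (cartesianProductWith)
  open import Data.List.Properties using (length-++; length-map)
  open import Data.List.Membership.Propositional using (_∈_)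
  open import Data.List.Membership.Propositional.Properties using (∈-map⁺; ∈-++⁺ˡ; ∈-++⁺ʳ; ∈-cartesianProductWith⁺)
  open import Data.List.Relation.Unary.All using (All; []; _∷_)
  open import Data.List.Relation.Unary.Any using (here; there)
  open import Data.Fin.Subset using (Subset; outside; inside) renaming (∣_∣ to size)
  open ≡ using (cong; cong₂)

  length-cartesianProductWith : ∀ {A B C : Set} (f : A → B → C) xs ys →
    length (cartesianProductWith f xs ys) ≡ length xs * length ys
  length-cartesianProductWith f [] ys = ≡.refl
  length-cartesianProductWith f (x ∷ xs) ys = ≡.trans (length-++ (map (f x) ys))
    (cong₂ _+_ (length-map (f x) ys) (length-cartesianProductWith f xs ys))

  module _ {A : Set} where

    listsUpTo : ℕ → List A → List (List A)
    listsUpTo zero E = [] ∷ []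
    listsUpTo (suc M) E = [] ∷ cartesianProductWith _∷_ E (listsUpTo M E)

    length-listsUpTo : ∀ M E → length (listsUpTo M E) ≤ suc (length E) ^ M
    length-listsUpTo zero E = ≤-refl
    length-listsUpTo (suc M) E = begin
      suc (length (cartesianProductWith _∷_ E (listsUpTo M E))) ≡⟨ cong suc (length-cartesianProductWith _∷_ E _) ⟩
      suc (length E * length (listsUpTo M E))                   ≤⟨ s≤s (*-monoʳ-≤ (length E) (length-listsUpTo M E)) ⟩
      suc (length E * P)                                        ≤⟨ +-monoˡ-≤ (length E * P) (m^n>0 (suc (length E)) M) ⟩
      suc (length E) * P                                        ∎
      where
      open ≤-Reasoning
      P = suc (length E) ^ M

    ∈-listsUpTo : ∀ M E {xs} → All (_∈ E) xs → length xs ≤ M → xs ∈ listsUpTo M E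
    ∈-listsUpTo zero E [] _ = here ≡.refl
    ∈-listsUpTo (suc M) E [] _ = here ≡.refl
    ∈-listsUpTo (suc M) E (x∈E ∷ xs⊆E) (s≤s |xs|≤M) =
      there (∈-cartesianProductWith⁺ _∷_ x∈E (∈-listsUpTo M E xs⊆E |xs|≤M))

  ∈-cube : ∀ {n} (x : Cube n) → x ∈ cube n
  ∈-cube [] = here ≡.refl
  ∈-cube (true ∷ x) = ∈-++⁺ˡ (∈-map⁺ (true ∷_) (∈-cube x))
  ∈-cube {suc n} (false ∷ x) = ∈-++⁺ʳ (map (true ∷_) (cube n)) (∈-map⁺ (false ∷_) (∈-cube x))

  subsetsUpTo : (n k : ℕ) → List (Subset n)
  subsetsUpTo zero k = [] ∷ []
  subsetsUpTo (suc n) zero = map (outside ∷_) (subsetsUpTo n zero)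
  subsetsUpTo (suc n) (suc k) = map (inside ∷_) (subsetsUpTo n k) ++ map (outside ∷_) (subsetsUpTo n (suc k))

  length-subsetsUpTo : ∀ n k → length (subsetsUpTo n k) ≤ suc n ^ k
  length-subsetsUpTo zero k = ≤-reflexive (≡.sym (^-zeroˡ k))
  length-subsetsUpTo (suc n) zero = ≤-trans (≤-reflexive (length-map (outside ∷_) (subsetsUpTo n zero))) (length-subsetsUpTo n zero)
  length-subsetsUpTo (suc n) (suc k) = begin
    length (map (inside ∷_) (subsetsUpTo n k) ++ map (outside ∷_) (subsetsUpTo n (suc k)))
      ≡⟨ ≡.trans (length-++ (map (inside ∷_) (subsetsUpTo n k)))
                 (cong₂ _+_ (length-map _ (subsetsUpTo n k)) (length-map _ (subsetsUpTo n (suc k)))) ⟩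
    length (subsetsUpTo n k) + length (subsetsUpTo n (suc k))
      ≤⟨ +-mono-≤ (length-subsetsUpTo n k) (length-subsetsUpTo n (suc k)) ⟩
    suc n ^ k + suc n * suc n ^ k
      ≤⟨ *-monoʳ-≤ (suc (suc n)) (^-monoˡ-≤ k (n≤1+n (suc n))) ⟩
    suc (suc n) * suc (suc n) ^ k ∎
    where open ≤-Reasoning

  ∈-subsetsUpTo : ∀ {n} k (T : Subset n) → size T ≤ k → T ∈ subsetsUpTo n k
  ∈-subsetsUpTo {zero} k [] _ = here ≡.refl
  ∈-subsetsUpTo {suc n} zero (outside ∷ T) |T|≤k = ∈-map⁺ (outside ∷_) (∈-subsetsUpTo zero T |T|≤k)
  ∈-subsetsUpTo {suc n} (suc k) (inside ∷ T) (s≤s |T|≤k) = ∈-++⁺ˡ (∈-map⁺ (inside ∷_) (∈-subsetsUpTo k T |T|≤k))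
  ∈-subsetsUpTo {suc n} (suc k) (outside ∷ T) |T|≤k =
    ∈-++⁺ʳ (map (inside ∷_) (subsetsUpTo n k)) (∈-map⁺ (outside ∷_) (∈-subsetsUpTo (suc k) T |T|≤k))

module Pigeonhole {X : Set} (_≟_ : DecidableEquality X) where

  open import Data.Nat using (_*_; _≤_; z≤n; s≤s)
  open import Data.Nat.Properties hiding (_≟_)
  open import Data.Bool.Properties using (T-≡)
  open import Function.Bundles using (Equivalence)
  open import Data.Fin as Fin using (Fin)
  open import Data.Fin.Subset using (Subset; _∈_) renaming (∣_∣ to size)
  import Data.Vec as Vec
  import Data.Vec.Properties as Vec
  open import Data.List using (allFin)
  open import Data.List.Properties using (length-tabulate)
  open import Data.List.Extrema.Nat using (argmax; f[xs]≤f[argmax])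
  open import Data.Product using (Σ; _,_)
  open import Data.Empty using (⊥-elim)
  import Data.List.Membership.Propositional as List
  open import Data.List.Relation.Unary.Any using (here; there)
  open import Relation.Nullary using (yes; no)
  open import Relation.Nullary.Decidable using (⌊_⌋; toWitness)
  open ℕSum
  open ≡ using (cong)

  [_≡_] : X → X → ℕ
  [ x ≡ y ] = if ⌊ x ≟ y ⌋ then 1 else 0

  preimage : ∀ {s} → (Fin s → X) → X → Subset s
  preimage f x = Vec.tabulate (λ i → ⌊ f i ≟ x ⌋)

  ∈-preimage⁻ : ∀ {s} (f : Fin s → X) {x} i → i ∈ preimage f x → f i ≡ x
  ∈-preimage⁻ f i i∈ = toWitness (Equivalence.from T-≡ (≡.trans (≡.sym (Vec.lookup∘tabulate _ i)) (Vec.[]=⇒lookup i∈)))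

  size-preimage : ∀ {s} (f : Fin s → X) x → size (preimage f x) ≡ ∑ (λ i → [ f i ≡ x ]) (allFin s)
  size-preimage {zero} f x = ≡.refl
  size-preimage {suc s} f x with f Fin.zero ≟ x | ∑-allFin-suc (λ i → [ f i ≡ x ])
  ... | yes _ | split = ≡.trans (cong suc (size-preimage (f ∘ Fin.suc) x)) (≡.sym split)
  ... | no _  | split = ≡.trans (size-preimage (f ∘ Fin.suc) x) (≡.sym split)

  1≤∑[≡] : ∀ {y} C → y List.∈ C → 1 ≤ ∑ (λ c → [ y ≡ c ]) C
  1≤∑[≡] {y} (c ∷ C) (here ≡.refl) with y ≟ y
  ... | yes _ = s≤s z≤n
  ... | no y≢y = ⊥-elim (y≢y ≡.refl)
  1≤∑[≡] (c ∷ C) (there y∈C) = ≤-trans (1≤∑[≡] C y∈C) (m≤n+m _ _)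

  pigeonhole : ∀ {s} (f : Fin s → X) (C : List X) → (∀ i → f i List.∈ C) → X →
    Σ X λ x → s ≤ size (preimage f x) * length C
  pigeonhole {s} f C f∈C x₀ = x , ≤-trans s≤
    (≤-reflexive (≡.trans (*-comm (length C) _) (cong (_* length C) (≡.sym (size-preimage f x)))))
    where
    weight : X → ℕ
    weight y = ∑ (λ i → [ f i ≡ y ]) (allFin s)
    x = argmax weight x₀ C
    open ≤-Reasoning
    s≤ : s ≤ length C * weight x
    s≤ = begin
      s                                                    ≡⟨ ≡.sym (≡.trans (∑-const 1 (allFin s))
                                                                (≡.trans (*-identityʳ _) (length-tabulate (λ i → i)))) ⟩
      ∑ (λ _ → 1) (allFin s)                               ≤⟨ ∑-mono-≤ (λ i → 1≤∑[≡] C (f∈C i)) (allFin s) ⟩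
      ∑ (λ i → ∑ (λ y → [ f i ≡ y ]) C) (allFin s)         ≡⟨ ∑-comm (λ i y → [ f i ≡ y ]) (allFin s) C ⟩
      ∑ weight C                                           ≤⟨ ∑≤length*bound (f[xs]≤f[argmax] {f = weight} x₀ C) ⟩
      length C * weight x                                  ∎

module Junta where

  open import Data.Fin using (Fin) renaming (zero to fzero; suc to fsuc)
  open import Data.Fin.Subset using (Subset; _∈_; outside)
  open import Data.Vec using (lookup; there)

  module _ {n : ℕ} {J : Subset n} where

    determinedBy-∘ : ∀ {D E : Set} {g : Cube n → D} (h : D → E) → DeterminedBy J g → DeterminedBy J (h ∘ g)
    determinedBy-∘ h det x y agree = ≡.cong h (det x y agree)

    determinedBy-₂ : ∀ {D E F : Set} {f : Cube n → D} {g : Cube n → E} (h : D → E → F) →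
      DeterminedBy J f → DeterminedBy J g → DeterminedBy J (λ x → h (f x) (g x))
    determinedBy-₂ h detf detg x y agree = ≡.cong₂ h (detf x y agree) (detg x y agree)

  module _ {n : ℕ} {D : Set} {J : Subset n} {g : Cube (suc n) → D} where

    determinedBy-tail : ∀ {j} → DeterminedBy (j ∷ J) g → (b : Bool) → DeterminedBy J (g ∘ (b ∷_))
    determinedBy-tail {j} det b x y agree = det (b ∷ x) (b ∷ y) agree′
      where
      agree′ : ∀ i → i ∈ j ∷ J → lookup (b ∷ x) i ≡ lookup (b ∷ y) i
      agree′ fzero _ = ≡.refl
      agree′ (fsuc i) (there i∈J) = agree i i∈J

    determinedBy-outside : DeterminedBy (outside ∷ J) g → ∀ x → g (false ∷ x) ≡ g (true ∷ x)
    determinedBy-outside det x = det (false ∷ x) (true ∷ x) agree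
      where
      agree : ∀ i → i ∈ outside ∷ J → lookup (false ∷ x) i ≡ lookup (true ∷ x) i
      agree (fsuc i) (there _) = ≡.refl

module Walsh where

  open import Data.Integer using (ℤ; +_; 0ℤ; _+_; _-_; _*_; ∣_∣)
  open import Data.Integer.Properties using (∣i+j∣≤∣i∣+∣j∣; ∣i-j∣≤∣i∣+∣j∣; ∣i∣≡0⇒i≡0; +-inverseʳ; pos-*; *-distribˡ-+; *-identityˡ)
  open import Data.Integer.Tactic.RingSolver using (solve-∀)
  import Data.Nat as ℕ
  import Data.Nat.Properties as ℕP
  open import Data.Fin.Subset using (Subset; _⊆_; outside; inside)
  open import Data.Fin.Subset.Properties using (out⊆; in⊆in)
  open import Relation.Nullary using (¬_)
  open import Data.Empty using (⊥-elim)
  open ℤSum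
  open Junta
  open ≡ using (cong; cong₂)
  open ≡.≡-Reasoning

  -- walsh a T = ∑ₓ (-1)^|x ∩ T| a x, reading a vector of Cube n as the subset where it is true.
  walsh : ∀ {n} → (Cube n → ℤ) → Cube n → ℤ
  walsh {zero} a [] = a []
  walsh {suc n} a (true ∷ T) = walsh (λ x → a (false ∷ x) - a (true ∷ x)) T
  walsh {suc n} a (false ∷ T) = walsh (λ x → a (false ∷ x) + a (true ∷ x)) T

  walsh-cong : ∀ {n} {a b : Cube n → ℤ} → (∀ x → a x ≡ b x) → ∀ T → walsh a T ≡ walsh b T
  walsh-cong {zero} a≡b [] = a≡b []
  walsh-cong {suc n} a≡b (true ∷ T) = walsh-cong (λ x → cong₂ _-_ (a≡b (false ∷ x)) (a≡b (true ∷ x))) T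
  walsh-cong {suc n} a≡b (false ∷ T) = walsh-cong (λ x → cong₂ _+_ (a≡b (false ∷ x)) (a≡b (true ∷ x))) T

  walsh-linear : ∀ {n} (u v : ℤ) (a b : Cube n → ℤ) T →
    walsh (λ x → u * a x - v * b x) T ≡ u * walsh a T - v * walsh b T
  walsh-linear {zero} u v a b [] = ≡.refl
  walsh-linear {suc n} u v a b (true ∷ T) = ≡.trans
    (walsh-cong (λ x → regroup u v (a (false ∷ x)) (a (true ∷ x)) (b (false ∷ x)) (b (true ∷ x))) T)
    (walsh-linear u v _ _ T)
    where
    regroup : ∀ u v a₀ a₁ b₀ b₁ → (u * a₀ - v * b₀) - (u * a₁ - v * b₁) ≡ u * (a₀ - a₁) - v * (b₀ - b₁)
    regroup = solve-∀
  walsh-linear {suc n} u v a b (false ∷ T) = ≡.trans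
    (walsh-cong (λ x → regroup u v (a (false ∷ x)) (a (true ∷ x)) (b (false ∷ x)) (b (true ∷ x))) T)
    (walsh-linear u v _ _ T)
    where
    regroup : ∀ u v a₀ a₁ b₀ b₁ → (u * a₀ - v * b₀) + (u * a₁ - v * b₁) ≡ u * (a₀ + a₁) - v * (b₀ + b₁)
    regroup = solve-∀

  plancherel : ∀ n (a b : Cube n → ℤ) →
    ∑ (λ T → walsh a T * walsh b T) (cube n) ≡ + (2 ℕ.^ n) * ∑ (λ x → a x * b x) (cube n)
  plancherel zero a b = ≡.sym (*-identityˡ _)
  plancherel (suc n) a b = begin
    ∑ (λ T → walsh a T * walsh b T) (cube (suc n))
      ≡⟨ ∑-cube-suc (λ T → walsh a T * walsh b T) ⟩
    ∑ (λ T → walsh a⁻ T * walsh b⁻ T) (cube n) + ∑ (λ T → walsh a⁺ T * walsh b⁺ T) (cube n)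
      ≡⟨ cong₂ _+_ (plancherel n a⁻ b⁻) (plancherel n a⁺ b⁺) ⟩
    P * ∑ (λ x → a⁻ x * b⁻ x) (cube n) + P * ∑ (λ x → a⁺ x * b⁺ x) (cube n)
      ≡⟨ ≡.sym (*-distribˡ-+ P _ _) ⟩
    P * (∑ (λ x → a⁻ x * b⁻ x) (cube n) + ∑ (λ x → a⁺ x * b⁺ x) (cube n))
      ≡⟨ cong (P *_) (≡.sym (∑-distrib-+ _ _ (cube n))) ⟩
    P * ∑ (λ x → a⁻ x * b⁻ x + a⁺ x * b⁺ x) (cube n)
      ≡⟨ cong (P *_) (∑-cong (λ x → polarise (a (false ∷ x)) (a (true ∷ x)) (b (false ∷ x)) (b (true ∷ x))) (cube n)) ⟩
    P * ∑ (λ x → + 2 * (a (true ∷ x) * b (true ∷ x) + a (false ∷ x) * b (false ∷ x))) (cube n)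
      ≡⟨ cong (P *_) (≡.sym (*-distribˡ-∑ (+ 2) _ (cube n))) ⟩
    P * (+ 2 * ∑ (λ x → a (true ∷ x) * b (true ∷ x) + a (false ∷ x) * b (false ∷ x)) (cube n))
      ≡⟨ cong (λ z → P * (+ 2 * z)) (∑-distrib-+ _ _ (cube n)) ⟩
    P * (+ 2 * (∑ (λ x → a (true ∷ x) * b (true ∷ x)) (cube n) + ∑ (λ x → a (false ∷ x) * b (false ∷ x)) (cube n)))
      ≡⟨ cong (λ z → P * (+ 2 * z)) (≡.sym (∑-cube-suc {n} (λ x → a x * b x))) ⟩
    P * (+ 2 * ∑ (λ x → a x * b x) (cube (suc n)))
      ≡⟨ reassoc P _ ⟩
    (+ 2 * P) * ∑ (λ x → a x * b x) (cube (suc n))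
      ≡⟨ cong (_* ∑ (λ x → a x * b x) (cube (suc n))) (≡.sym (pos-* 2 (2 ℕ.^ n))) ⟩
    + (2 ℕ.^ suc n) * ∑ (λ x → a x * b x) (cube (suc n)) ∎
    where
    P = + (2 ℕ.^ n)
    a⁻ a⁺ b⁻ b⁺ : Cube n → ℤ
    a⁻ x = a (false ∷ x) - a (true ∷ x)
    a⁺ x = a (false ∷ x) + a (true ∷ x)
    b⁻ x = b (false ∷ x) - b (true ∷ x)
    b⁺ x = b (false ∷ x) + b (true ∷ x)
    polarise : ∀ a₀ a₁ b₀ b₁ → (a₀ - a₁) * (b₀ - b₁) + (a₀ + a₁) * (b₀ + b₁) ≡ + 2 * (a₁ * b₁ + a₀ * b₀)
    polarise = solve-∀
    reassoc : ∀ p z → p * (+ 2 * z) ≡ (+ 2 * p) * z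
    reassoc = solve-∀

  ∑∣∣≤∑∣∣-cube-suc : ∀ {n} (a : Cube (suc n) → ℤ) (c : Cube n → ℤ) →
    (∀ x → ∣ c x ∣ ℕ.≤ ∣ a (false ∷ x) ∣ ℕ.+ ∣ a (true ∷ x) ∣) →
    ℕSum.∑ (λ x → ∣ c x ∣) (cube n) ℕ.≤ ℕSum.∑ (λ x → ∣ a x ∣) (cube (suc n))
  ∑∣∣≤∑∣∣-cube-suc {n} a c c≤ = ℕP.≤-trans (ℕSum.∑-mono-≤ c≤ (cube n)) (ℕP.≤-reflexive (begin
    ℕSum.∑ (λ x → ∣ a (false ∷ x) ∣ ℕ.+ ∣ a (true ∷ x) ∣) (cube n)
      ≡⟨ ℕSum.∑-distrib-+ _ _ (cube n) ⟩
    ℕSum.∑ (λ x → ∣ a (false ∷ x) ∣) (cube n) ℕ.+ ℕSum.∑ (λ x → ∣ a (true ∷ x) ∣) (cube n)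
      ≡⟨ ℕP.+-comm (ℕSum.∑ (λ x → ∣ a (false ∷ x) ∣) (cube n)) _ ⟩
    ℕSum.∑ (λ x → ∣ a (true ∷ x) ∣) (cube n) ℕ.+ ℕSum.∑ (λ x → ∣ a (false ∷ x) ∣) (cube n)
      ≡⟨ ≡.sym (ℕSum.∑-cube-suc (λ x → ∣ a x ∣)) ⟩
    ℕSum.∑ (λ x → ∣ a x ∣) (cube (suc n)) ∎))

  ∣walsh∣≤∑∣∣ : ∀ {n} (a : Cube n → ℤ) T → ∣ walsh a T ∣ ℕ.≤ ℕSum.∑ (λ x → ∣ a x ∣) (cube n)
  ∣walsh∣≤∑∣∣ {zero} a [] = ℕP.≤-reflexive (≡.sym (ℕP.+-identityʳ _))
  ∣walsh∣≤∑∣∣ {suc n} a (true ∷ T) = ℕP.≤-trans (∣walsh∣≤∑∣∣ _ T)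
    (∑∣∣≤∑∣∣-cube-suc a (λ x → a (false ∷ x) - a (true ∷ x)) (λ x → ∣i-j∣≤∣i∣+∣j∣ (a (false ∷ x)) (a (true ∷ x))))
  ∣walsh∣≤∑∣∣ {suc n} a (false ∷ T) = ℕP.≤-trans (∣walsh∣≤∑∣∣ _ T)
    (∑∣∣≤∑∣∣-cube-suc a (λ x → a (false ∷ x) + a (true ∷ x)) (λ x → ∣i+j∣≤∣i∣+∣j∣ (a (false ∷ x)) (a (true ∷ x))))

  walsh-vanishes : ∀ {n} {a : Cube n → ℤ} → (∀ x → a x ≡ 0ℤ) → ∀ T → walsh a T ≡ 0ℤ
  walsh-vanishes {n} {a} a≡0 T = ∣i∣≡0⇒i≡0 (ℕP.n≤0⇒n≡0 (ℕP.≤-trans (∣walsh∣≤∑∣∣ a T)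
    (ℕP.≤-reflexive (ℕSum.∑-zero (λ x → cong ∣_∣ (a≡0 x)) (cube n)))))

  walsh-junta : ∀ {n} {J : Subset n} {a : Cube n → ℤ} → DeterminedBy J a → ∀ T → ¬ T ⊆ J → walsh a T ≡ 0ℤ
  walsh-junta {zero} {[]} det [] T⊈J = ⊥-elim (T⊈J (λ ()))
  walsh-junta {suc n} {outside ∷ J} {a} det (true ∷ T) _ = walsh-vanishes a⁰-a¹≡0 T
    where
    a⁰-a¹≡0 : ∀ x → a (false ∷ x) - a (true ∷ x) ≡ 0ℤ
    a⁰-a¹≡0 x = ≡.trans (cong (_- a (true ∷ x)) (determinedBy-outside det x)) (+-inverseʳ (a (true ∷ x)))
  walsh-junta {suc n} {inside ∷ J} det (true ∷ T) T⊈J =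
    walsh-junta (determinedBy-₂ _-_ (determinedBy-tail det false) (determinedBy-tail det true)) T (T⊈J ∘ in⊆in)
  walsh-junta {suc n} {j ∷ J} det (false ∷ T) T⊈J =
    walsh-junta (determinedBy-₂ _+_ (determinedBy-tail det false) (determinedBy-tail det true)) T (T⊈J ∘ out⊆)

module Fibres where

  open import Data.Nat using (_+_; _*_; _^_; _≤_)
  open import Data.Nat.Properties
  open import Data.Integer as ℤ using (ℤ; 0ℤ; 1ℤ; ∣_∣)
  import Data.Integer.Properties as ℤP
  open import Data.Fin as Fin using (Fin)
  open import Data.Fin.Subset using (Subset; _⊆_; outside; inside) renaming (∣_∣ to size)
  open import Data.Fin.Subset.Properties using (_⊆?_)
  open import Data.List using (allFin)
  open import Relation.Nullary using (yes; no; does)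
  open import Relation.Nullary.Decidable using (⌊_⌋)
  open ℕSum
  open Walsh
  open Junta
  open ≡ using (cong; cong₂)

  fibre : ∀ {n m} → (Cube n → Fin m) → Fin m → Cube n → ℤ
  fibre g d x = if ⌊ g x Fin.≟ d ⌋ then 1ℤ else 0ℤ

  [_≡_] : ∀ {m} → Fin m → Fin m → ℕ
  [ y ≡ d ] = if ⌊ y Fin.≟ d ⌋ then 1 else 0

  ∑[≡] : ∀ {m} (y : Fin m) → ∑ (λ d → [ y ≡ d ]) (allFin m) ≡ 1
  ∑[≡] {suc m} Fin.zero = ≡.trans (∑-allFin-suc {m} (λ d → [ Fin.zero ≡ d ])) (cong suc (∑-zero (λ _ → ≡.refl) (allFin m)))
  ∑[≡] {suc m} (Fin.suc y) = ≡.trans (∑-allFin-suc (λ d → [ Fin.suc y ≡ d ])) (≡.trans (∑-cong [≡]-suc (allFin m)) (∑[≡] y))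
    where
    [≡]-suc : ∀ d → [ Fin.suc y ≡ Fin.suc d ] ≡ [ y ≡ d ]
    [≡]-suc d with y Fin.≟ d
    ... | yes _ = ≡.refl
    ... | no _ = ≡.refl

  ∣fibre∣≡[≡] : ∀ {n m} (g : Cube n → Fin m) d x → ∣ fibre g d x ∣ ≡ [ g x ≡ d ]
  ∣fibre∣≡[≡] g d x with ⌊ g x Fin.≟ d ⌋
  ... | true = ≡.refl
  ... | false = ≡.refl

  ∑∣walsh-fibre∣≤2^n : ∀ {n m} (g : Cube n → Fin m) T → ∑ (λ d → ∣ walsh (fibre g d) T ∣) (allFin m) ≤ 2 ^ n
  ∑∣walsh-fibre∣≤2^n {n} {m} g T = ≤-trans (∑-mono-≤ (λ d → ∣walsh∣≤∑∣∣ (fibre g d) T) (allFin m)) (≤-reflexive (begin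
    ∑ (λ d → ∑ (λ x → ∣ fibre g d x ∣) (cube n)) (allFin m)  ≡⟨ ∑-comm (λ d x → ∣ fibre g d x ∣) (allFin m) (cube n) ⟩
    ∑ (λ x → ∑ (λ d → ∣ fibre g d x ∣) (allFin m)) (cube n)
      ≡⟨ ∑-cong (λ x → ≡.trans (∑-cong (λ d → ∣fibre∣≡[≡] g d x) (allFin m)) (∑[≡] (g x))) (cube n) ⟩
    ∑ (λ _ → 1) (cube n)                                       ≡⟨ ∑-const 1 (cube n) ⟩
    length (cube n) * 1                                        ≡⟨ ≡.trans (*-identityʳ _) (length-cube n) ⟩
    2 ^ n                                                      ∎))
    where open ≡.≡-Reasoning

  ∑⊆ : ∀ {n} → Subset n → (Cube n → ℕ) → ℕ
  ∑⊆ {n} J f = ∑ (λ T → if does (T ⊆? J) then f T else 0) (cube n)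

  ∑⊆-1 : ∀ {n} (J : Subset n) → ∑⊆ J (λ _ → 1) ≡ 2 ^ size J
  ∑⊆-1 {zero} [] = ≡.refl
  ∑⊆-1 {suc n} (inside ∷ J) = ≡.trans (∑-cube-suc {n} (λ T → if does (T ⊆? inside ∷ J) then 1 else 0))
    (cong₂ _+_ (∑⊆-1 J) (≡.trans (∑⊆-1 J) (≡.sym (+-identityʳ _))))
  ∑⊆-1 {suc n} (outside ∷ J) = ≡.trans (∑-cube-suc {n} (λ T → if does (T ⊆? outside ∷ J) then 1 else 0))
    (cong₂ _+_ (∑-zero (λ _ → ≡.refl) (cube n)) (∑⊆-1 J))

  *-∑⊆-≤ : ∀ {n} (J : Subset n) (f : Cube n → ℕ) (w v : ℕ) → (∀ T → T ⊆ J → w * f T ≤ v) →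
    w * ∑⊆ J f ≤ 2 ^ size J * v
  *-∑⊆-≤ {n} J f w v w*f≤v = begin
    w * ∑⊆ J f                                              ≡⟨ *-distribˡ-∑ w _ (cube n) ⟩
    ∑ (λ T → w * (if does (T ⊆? J) then f T else 0)) (cube n) ≤⟨ ∑-mono-≤ termwise (cube n) ⟩
    ∑ (λ T → v * (if does (T ⊆? J) then 1 else 0)) (cube n) ≡⟨ ≡.sym (*-distribˡ-∑ v _ (cube n)) ⟩
    v * ∑⊆ J (λ _ → 1)                                      ≡⟨ ≡.trans (cong (v *_) (∑⊆-1 J)) (*-comm v _) ⟩
    2 ^ size J * v                                          ∎
    where
    open ≤-Reasoning
    termwise : ∀ T → w * (if does (T ⊆? J) then f T else 0) ≤ v * (if does (T ⊆? J) then 1 else 0)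
    termwise T with T ⊆? J
    ... | yes T⊆J = ≤-trans (w*f≤v T T⊆J) (≤-reflexive (≡.sym (*-identityʳ v)))
    ... | no _ = ≤-reflexive (≡.trans (*-zeroʳ w) (≡.sym (*-zeroʳ v)))

  fibreSum : ∀ {n m} → (Cube n → ℤ) → (Cube n → Fin m) → Fin m → ℤ
  fibreSum {n} a g d = ℤSum.∑ (λ x → a x ℤ.* fibre g d x) (cube n)

  -- Plancherel against the fibre indicators, whose transforms vanish off the subsets of J and have
  -- total mass at most 2ⁿ at each T.
  ∑∣fibreSum∣≤∑⊆∣walsh∣ : ∀ {n m} {J : Subset n} (g : Cube n → Fin m) → DeterminedBy J g → (a : Cube n → ℤ) →
    ∑ (λ d → ∣ fibreSum a g d ∣) (allFin m) ≤ ∑⊆ J (λ T → ∣ walsh a T ∣)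
  ∑∣fibreSum∣≤∑⊆∣walsh∣ {n} {m} {J} g det a = *-cancelˡ-≤ (2 ^ n) {{m^n≢0 2 n}} (begin
    2 ^ n * ∑ (λ d → ∣ fibreSum a g d ∣) (allFin m)
      ≡⟨ *-distribˡ-∑ (2 ^ n) _ (allFin m) ⟩
    ∑ (λ d → 2 ^ n * ∣ fibreSum a g d ∣) (allFin m)
      ≡⟨ ∑-cong (λ d → ≡.trans (≡.sym (ℤP.abs-* (ℤ.+ (2 ^ n)) _)) (cong ∣_∣ (≡.sym (plancherel n a (fibre g d))))) (allFin m) ⟩
    ∑ (λ d → ∣ ℤSum.∑ (λ T → walsh a T ℤ.* walsh (fibre g d) T) (cube n) ∣) (allFin m)
      ≤⟨ ∑-mono-≤ (λ d → ≤-trans (ℤSum.∣∑∣≤∑∣∣ _ (cube n))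
                     (≤-reflexive (∑-cong (λ T → ℤP.abs-* (walsh a T) (walsh (fibre g d) T)) (cube n)))) (allFin m) ⟩
    ∑ (λ d → ∑ (λ T → ∣ walsh a T ∣ * ∣ walsh (fibre g d) T ∣) (cube n)) (allFin m)
      ≡⟨ ∑-comm _ (allFin m) (cube n) ⟩
    ∑ (λ T → ∑ (λ d → ∣ walsh a T ∣ * ∣ walsh (fibre g d) T ∣) (allFin m)) (cube n)
      ≡⟨ ∑-cong (λ T → ≡.sym (*-distribˡ-∑ ∣ walsh a T ∣ _ (allFin m))) (cube n) ⟩
    ∑ (λ T → ∣ walsh a T ∣ * ∑ (λ d → ∣ walsh (fibre g d) T ∣) (allFin m)) (cube n)
      ≤⟨ ∑-mono-≤ termwise (cube n) ⟩
    ∑ (λ T → 2 ^ n * (if does (T ⊆? J) then ∣ walsh a T ∣ else 0)) (cube n)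
      ≡⟨ ≡.sym (*-distribˡ-∑ (2 ^ n) _ (cube n)) ⟩
    2 ^ n * ∑⊆ J (λ T → ∣ walsh a T ∣) ∎)
    where
    open ≤-Reasoning
    termwise : ∀ T → ∣ walsh a T ∣ * ∑ (λ d → ∣ walsh (fibre g d) T ∣) (allFin m) ≤
                     2 ^ n * (if does (T ⊆? J) then ∣ walsh a T ∣ else 0)
    termwise T with T ⊆? J
    ... | yes _ = ≤-trans (*-monoʳ-≤ ∣ walsh a T ∣ (∑∣walsh-fibre∣≤2^n g T)) (≤-reflexive (*-comm _ (2 ^ n)))
    ... | no T⊈J = ≤-reflexive (≡.trans (cong (∣ walsh a T ∣ *_) (∑-zero fibre-coefficient≡0 (allFin m)))
                                          (≡.trans (*-zeroʳ ∣ walsh a T ∣) (≡.sym (*-zeroʳ (2 ^ n)))))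
      where
      fibre-coefficient≡0 : ∀ d → ∣ walsh (fibre g d) T ∣ ≡ 0
      fibre-coefficient≡0 d = cong ∣_∣ (walsh-junta (determinedBy-∘ (λ y → if ⌊ y Fin.≟ d ⌋ then 1ℤ else 0ℤ) det) T T⊈J)

module Rationals where

  import Data.Nat as ℕ
  import Data.Nat.Properties as ℕP
  open import Data.Integer as ℤ using (ℤ; +_; +[1+_]; -[1+_])
  import Data.Integer.Properties as ℤP
  open import Data.Integer.Tactic.RingSolver using (solve-∀)
  open import Data.Rational as ℚ using (ℚ; mkℚ; 0ℚ; _/_; toℚᵘ; ↧ₙ_)
  import Data.Rational.Properties as ℚP
  open import Data.Rational.Unnormalised as ℚᵘ using (mkℚᵘ; *≡*; *≤*)
  import Data.Rational.Unnormalised.Properties as ℚᵘP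
  open import Data.Empty using (⊥-elim)
  open ≡ using (cong)

  module ℚSum = Summation (CommutativeRing.commutativeSemiring ℚP.+-*-commutativeRing)

  toℚᵘ-/ : ∀ i d → toℚᵘ (i / suc d) ℚᵘ.≃ mkℚᵘ i d
  toℚᵘ-/ i d = ℚP.toℚᵘ-fromℚᵘ (mkℚᵘ i d)

  ∣a/p-b/q∣ : ∀ (a b p q : ℕ) →
    ℚ.∣ (+ a) / suc p ℚ.- (+ b) / suc q ∣ ≡ (+ ℤ.∣ + suc q ℤ.* + a ℤ.- + suc p ℤ.* + b ∣) / (suc p ℕ.* suc q)
  ∣a/p-b/q∣ a b p q = ℚP.toℚᵘ-injective (ℚᵘP.≃-trans lhs≃ (ℚᵘP.≃-sym (toℚᵘ-/ _ (ℕ.pred (suc p ℕ.* suc q)))))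
    where
    X = (+ a) / suc p
    Y = (+ b) / suc q
    cross : ∀ a b p q → a ℤ.* q ℤ.+ ℤ.- b ℤ.* p ≡ q ℤ.* a ℤ.- p ℤ.* b
    cross = solve-∀
    lhs≃ : toℚᵘ ℚ.∣ X ℚ.- Y ∣ ℚᵘ.≃ mkℚᵘ (+ ℤ.∣ + suc q ℤ.* + a ℤ.- + suc p ℤ.* + b ∣) (ℕ.pred (suc p ℕ.* suc q))
    lhs≃ = ℚᵘP.≃-trans (ℚP.toℚᵘ-homo-∣-∣ (X ℚ.- Y))
      (ℚᵘP.≃-trans (ℚᵘP.∣-∣-cong (ℚᵘP.≃-trans (ℚP.toℚᵘ-homo-+ X (ℚ.- Y))
        (ℚᵘP.+-cong (toℚᵘ-/ (+ a) p) (ℚᵘP.≃-trans (ℚP.toℚᵘ-homo‿- Y) (ℚᵘP.-‿cong (toℚᵘ-/ (+ b) q))))))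
        (*≡* (cong (λ z → + ℤ.∣ z ∣ ℤ.* + (suc p ℕ.* suc q)) (cross (+ a) (+ b) (+ suc p) (+ suc q)))))

  ∑-/ : ∀ {A : Set} (f : A → ℕ) (d : ℕ) (xs : List A) →
    ℚSum.∑ (λ x → (+ f x) / suc d) xs ≡ (+ ℕSum.∑ f xs) / suc d
  ∑-/ f d [] = ≡.sym (ℚP.0/n≡0 (suc d))
  ∑-/ f d (x ∷ xs) = ≡.trans (cong ((+ f x) / suc d ℚ.+_) (∑-/ f d xs)) (ℚP.toℚᵘ-injective (begin
    toℚᵘ ((+ f x) / suc d ℚ.+ (+ S) / suc d)             ≈⟨ ℚP.toℚᵘ-homo-+ ((+ f x) / suc d) _ ⟩
    toℚᵘ ((+ f x) / suc d) ℚᵘ.+ toℚᵘ ((+ S) / suc d)     ≈⟨ ℚᵘP.+-cong (toℚᵘ-/ (+ f x) d) (toℚᵘ-/ (+ S) d) ⟩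
    mkℚᵘ (+ f x) d ℚᵘ.+ mkℚᵘ (+ S) d                      ≈⟨ *≡* (common-denominator (f x) S) ⟩
    mkℚᵘ (+ (f x ℕ.+ S)) d                                ≈⟨ ℚᵘP.≃-sym (toℚᵘ-/ (+ (f x ℕ.+ S)) d) ⟩
    toℚᵘ ((+ (f x ℕ.+ S)) / suc d)                        ∎))
    where
    open import Relation.Binary.Reasoning.Setoid ℚᵘP.≃-setoid
    S = ℕSum.∑ f xs
    common-denominator : ∀ u v → (+ u ℤ.* + suc d ℤ.+ + v ℤ.* + suc d) ℤ.* + suc d ≡ + (u ℕ.+ v) ℤ.* + (suc d ℕ.* suc d)
    common-denominator u v rewrite ℤP.pos-+ u v | ℤP.pos-* (suc d) (suc d) = distrib (+ u) (+ v) (+ suc d)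
      where
      distrib : ∀ u v e → (u ℤ.* e ℤ.+ v ℤ.* e) ℤ.* e ≡ (u ℤ.+ v) ℤ.* (e ℤ.* e)
      distrib = solve-∀

  -- A positive rational is at least 1 / its denominator.
  ↧*a≤b⇒a/b≤ : ∀ ν → 0ℚ ℚ.< ν → ∀ a b → ↧ₙ ν ℕ.* a ℕ.≤ suc b → (+ a) / suc b ℚ.≤ ν
  ↧*a≤b⇒a/b≤ (mkℚ +[1+ m ] d _) _ a b ↧*a≤b =
    ℚP.toℚᵘ-cancel-≤ (ℚᵘP.≤-respˡ-≃ (ℚᵘP.≃-sym (toℚᵘ-/ (+ a) b)) (*≤* cross))
    where
    cross : + a ℤ.* + suc d ℤ.≤ +[1+ m ] ℤ.* + suc b
    cross = ≡.subst₂ ℤ._≤_ (ℤP.pos-* a (suc d)) (ℤP.pos-* (suc m) (suc b))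
      (ℤ.+≤+ (ℕP.≤-trans (ℕP.≤-reflexive (ℕP.*-comm a (suc d))) (ℕP.≤-trans ↧*a≤b (ℕP.m≤n*m (suc b) (suc m)))))
  ↧*a≤b⇒a/b≤ ν@(mkℚ (+ 0) _ _) ν>0 _ _ _ = ⊥-elim (ℚP.<-irrefl (≡.sym (ℚP.↥p≡0⇒p≡0 ν ≡.refl)) ν>0)
  ↧*a≤b⇒a/b≤ ν@(mkℚ -[1+ _ ] _ _) ν>0 _ _ _ = ⊥-elim (ℚP.<-asym ν>0 (ℚP.negative⁻¹ ν))

  p*b≤c⇒b≤c*↧p : ∀ p → 0ℚ ℚ.< p → ∀ b c → p ℚ.* toℚ b ℚ.≤ toℚ c → b ℕ.≤ c ℕ.* ↧ₙ p
  p*b≤c⇒b≤c*↧p p@(mkℚ +[1+ m ] d _) _ b c p*b≤c =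
    ℕP.≤-trans (ℕP.m≤n*m b (suc m)) (ℤP.drop‿+≤+ (≡.subst₂ ℤ._≤_ lhs rhs (ℚᵘP.drop-*≤* unnormalised)))
    where
    unnormalised : mkℚᵘ +[1+ m ] d ℚᵘ.* mkℚᵘ (+ b) 0 ℚᵘ.≤ mkℚᵘ (+ c) 0
    unnormalised = ℚᵘP.≤-respʳ-≃ (toℚᵘ-/ (+ c) 0) (ℚᵘP.≤-respˡ-≃
      (ℚᵘP.≃-trans (ℚP.toℚᵘ-homo-* p (toℚ b)) (ℚᵘP.*-congˡ {mkℚᵘ +[1+ m ] d} (toℚᵘ-/ (+ b) 0)))
      (ℚP.toℚᵘ-mono-≤ p*b≤c))
    lhs : (+[1+ m ] ℤ.* + b) ℤ.* + 1 ≡ + (suc m ℕ.* b)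
    lhs = ≡.trans (ℤP.*-identityʳ _) (≡.sym (ℤP.pos-* (suc m) b))
    rhs : + c ℤ.* + (suc d ℕ.* 1) ≡ + (c ℕ.* suc d)
    rhs = ≡.trans (cong (λ e → + c ℤ.* + e) (ℕP.*-identityʳ (suc d))) (≡.sym (ℤP.pos-* c (suc d)))
  p*b≤c⇒b≤c*↧p p@(mkℚ (+ 0) _ _) p>0 _ _ _ = ⊥-elim (ℚP.<-irrefl (≡.sym (ℚP.↥p≡0⇒p≡0 p ≡.refl)) p>0)
  p*b≤c⇒b≤c*↧p p@(mkℚ -[1+ _ ] _ _) p>0 _ _ _ = ⊥-elim (ℚP.<-asym p>0 (ℚP.negative⁻¹ p))

module SetCoefficients where

  open import Data.Nat using (_+_; _*_; _^_; _≤_; pred; NonZero)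
  open import Data.Nat.Properties
  open import Data.Integer as ℤ using (ℤ; +_; -[1+_]; 0ℤ; 1ℤ; ∣_∣)
  import Data.Integer.Properties as ℤP
  open import Data.Integer.Tactic.RingSolver using (solve-∀)
  open import Data.Fin as Fin using (Fin)
  open import Data.Fin.Subset using (Subset; _⊆_) renaming (∣_∣ to size)
  open import Data.List using (allFin)
  open import Relation.Nullary.Decidable using (⌊_⌋)
  open ℕSum
  open Walsh
  open Fibres
  open Rationals
  open import Data.Rational as ℚ using (0ℚ; ↧ₙ_)
  open ≡ using (cong; cong₂)

  module _ {n : ℕ} where

    χ : SubsetCube n → Cube n → ℤ
    χ A x = if A x then 1ℤ else 0ℤ

    coeff : SubsetCube n → Cube n → ℤ
    coeff A = walsh (χ A)

    card≡∑∣χ∣ : ∀ A → card A ≡ ∑ (λ x → ∣ χ A x ∣) (cube n)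
    card≡∑∣χ∣ A = ∑-cong pointwise (cube n)
      where
      pointwise : ∀ x → (if A x then 1 else 0) ≡ ∣ χ A x ∣
      pointwise x with A x
      ... | true = ≡.refl
      ... | false = ≡.refl

    +card≡∑χ² : ∀ A → + card A ≡ ℤSum.∑ (λ x → χ A x ℤ.* χ A x) (cube n)
    +card≡∑χ² A = ≡.trans (ℤSum.+-∑ _ (cube n)) (ℤSum.∑-cong pointwise (cube n))
      where
      pointwise : ∀ x → + (if A x then 1 else 0) ≡ χ A x ℤ.* χ A x
      pointwise x with A x
      ... | true = ≡.refl
      ... | false = ≡.refl

    +cardFiber≡fibreSum : ∀ {m} A (g : Cube n → Fin m) d → + cardFiber A g d ≡ fibreSum (χ A) g d
    +cardFiber≡fibreSum A g d = ≡.trans (ℤSum.+-∑ _ (cube n)) (ℤSum.∑-cong pointwise (cube n))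
      where
      pointwise : ∀ x → + (if A x then (if ⌊ g x Fin.≟ d ⌋ then 1 else 0) else 0) ≡ χ A x ℤ.* fibre g d x
      pointwise x with A x | ⌊ g x Fin.≟ d ⌋
      ... | true | true = ≡.refl
      ... | true | false = ≡.refl
      ... | false | _ = ≡.refl

    ∣coeff∣≤card : ∀ A T → ∣ coeff A T ∣ ≤ card A
    ∣coeff∣≤card A T = ≤-trans (∣walsh∣≤∑∣∣ (χ A) T) (≤-reflexive (≡.sym (card≡∑∣χ∣ A)))

    parseval : ∀ A → ∑ (λ T → ∣ coeff A T ∣ * ∣ coeff A T ∣) (cube n) ≡ 2 ^ n * card A
    parseval A = ℤP.+-injective (begin
      + ∑ (λ T → ∣ coeff A T ∣ * ∣ coeff A T ∣) (cube n)   ≡⟨ ℤSum.+-∑ _ (cube n) ⟩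
      ℤSum.∑ (λ T → + (∣ coeff A T ∣ * ∣ coeff A T ∣)) (cube n) ≡⟨ ℤSum.∑-cong (λ T → +∣i∣*∣i∣≡i*i (coeff A T)) (cube n) ⟩
      ℤSum.∑ (λ T → coeff A T ℤ.* coeff A T) (cube n)        ≡⟨ plancherel n (χ A) (χ A) ⟩
      + (2 ^ n) ℤ.* ℤSum.∑ (λ x → χ A x ℤ.* χ A x) (cube n)  ≡⟨ cong (+ (2 ^ n) ℤ.*_) (≡.sym (+card≡∑χ² A)) ⟩
      + (2 ^ n) ℤ.* + card A                                  ≡⟨ ≡.sym (ℤP.pos-* (2 ^ n) (card A)) ⟩
      + (2 ^ n * card A)                                      ∎)
      where
      open ≡.≡-Reasoning
      +∣i∣*∣i∣≡i*i : ∀ i → + (∣ i ∣ * ∣ i ∣) ≡ i ℤ.* i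
      +∣i∣*∣i∣≡i*i (+ k) = ℤP.pos-* k k
      +∣i∣*∣i∣≡i*i -[1+ k ] = ≡.refl

    coeffGap : SubsetCube n → SubsetCube n → Cube n → ℕ
    coeffGap A B T = ∣ + card B ℤ.* coeff A T ℤ.- + card A ℤ.* coeff B T ∣

    fibreGap : ∀ {m} → SubsetCube n → SubsetCube n → (Cube n → Fin m) → ℕ
    fibreGap {m} A B g = ∑ (λ d → ∣ + card B ℤ.* + cardFiber A g d ℤ.- + card A ℤ.* + cardFiber B g d ∣) (allFin m)

    *-fibreGap-≤ : ∀ {m} {J : Subset n} A B (g : Cube n → Fin m) → DeterminedBy J g → (w v : ℕ) →
      (∀ T → T ⊆ J → w * coeffGap A B T ≤ v) → w * fibreGap A B g ≤ 2 ^ size J * v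
    *-fibreGap-≤ {m} {J} A B g det w v w*gap≤v = begin
      w * fibreGap A B g                            ≡⟨ cong (w *_) (∑-cong (λ d → cong ∣_∣ (gap≡fibreSum d)) (allFin m)) ⟩
      w * ∑ (λ d → ∣ fibreSum a g d ∣) (allFin m)   ≤⟨ *-monoʳ-≤ w (∑∣fibreSum∣≤∑⊆∣walsh∣ g det a) ⟩
      w * ∑⊆ J (λ T → ∣ walsh a T ∣)                ≤⟨ *-∑⊆-≤ J _ w v w*∣walsh∣≤v ⟩
      2 ^ size J * v                                ∎
      where
      open ≤-Reasoning
      a : Cube n → ℤ
      a x = + card B ℤ.* χ A x ℤ.- + card A ℤ.* χ B x
      w*∣walsh∣≤v : ∀ T → T ⊆ J → w * ∣ walsh a T ∣ ≤ v
      w*∣walsh∣≤v T T⊆J = ≤-trans (≤-reflexive (cong (λ z → w * ∣ z ∣) (walsh-linear (+ card B) (+ card A) (χ A) (χ B) T))) (w*gap≤v T T⊆J)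
      regroup : ∀ u v a b f → u ℤ.* (a ℤ.* f) ℤ.- v ℤ.* (b ℤ.* f) ≡ (u ℤ.* a ℤ.- v ℤ.* b) ℤ.* f
      regroup = solve-∀
      gap≡fibreSum : ∀ d → + card B ℤ.* + cardFiber A g d ℤ.- + card A ℤ.* + cardFiber B g d ≡ fibreSum a g d
      gap≡fibreSum d = ≡.trans (cong₂ (λ s t → + card B ℤ.* s ℤ.- + card A ℤ.* t) (+cardFiber≡fibreSum A g d) (+cardFiber≡fibreSum B g d))
        (≡.trans (cong₂ ℤ._-_ (ℤSum.*-distribˡ-∑ (+ card B) _ (cube n)) (ℤSum.*-distribˡ-∑ (+ card A) _ (cube n)))
        (≡.trans (≡.sym (ℤSum.∑-distrib-- _ _ (cube n)))
        (ℤSum.∑-cong (λ x → regroup (+ card B) (+ card A) (χ A x) (χ B x) (fibre g d x)) (cube n))))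

    TV≡fibreGap/ : ∀ {m} A B (g : Cube n → Fin m) {p q} → card A ≡ suc p → card B ≡ suc q →
      TV g A B ≡ (+ fibreGap A B g) ℚ./ (suc p * suc q)
    TV≡fibreGap/ {m} A B g {p} {q} cA cB = ≡.trans (ℚSum.∑-cong pointwise (allFin m)) (∑-/ _ _ (allFin m))
      where
      pointwise : ∀ d → ℚ.∣ prob A g d ℚ.- prob B g d ∣ ≡
        (+ ∣ + card B ℤ.* + cardFiber A g d ℤ.- + card A ℤ.* + cardFiber B g d ∣) ℚ./ (suc p * suc q)
      pointwise d = ≡.trans (cong₂ (λ s t → ℚ.∣ s ℚ.- t ∣) (cong (ratio _) cA) (cong (ratio _) cB))
        (≡.trans (∣a/p-b/q∣ (cardFiber A g d) (cardFiber B g d) p q)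
        (cong₂ (λ s t → (+ ∣ + s ℤ.* + cardFiber A g d ℤ.- + t ℤ.* + cardFiber B g d ∣) ℚ./ (suc p * suc q))
          (≡.sym cB) (≡.sym cA)))

    TV≤ : ∀ {m} A B .{{_ : NonZero (card A)}} .{{_ : NonZero (card B)}} (g : Cube n → Fin m) ν → 0ℚ ℚ.< ν →
      ↧ₙ ν * fibreGap A B g ≤ card A * card B → TV g A B ℚ.≤ ν
    TV≤ A B g ν ν>0 gap≤ = ≡.subst (ℚ._≤ ν) (≡.sym (TV≡fibreGap/ A B g cA cB))
      (↧*a≤b⇒a/b≤ ν ν>0 _ _ (≡.subst₂ (λ s t → ↧ₙ ν * fibreGap A B g ≤ s * t) cA cB gap≤))
      where
      cA : card A ≡ suc (pred (card A))
      cA = ≡.sym (suc-pred (card A))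
      cB : card B ≡ suc (pred (card B))
      cB = ≡.sym (suc-pred (card B))

module Closeness where

  import Data.Nat as ℕ
  import Data.Nat.Properties as ℕP
  import Data.Nat.Tactic.RingSolver as ℕRing
  open import Data.Integer using (ℤ; +_; _+_; _-_; _*_; -_; ∣_∣; _≤_; +≤+)
  open import Data.Integer.Properties
  open import Data.Integer.Tactic.RingSolver using (solve-∀)
  open import Data.Sum using (inj₁; inj₂)
  open ≡ using (cong; cong₂)

  y≤x+c⇒y-x≤c : ∀ {x y c : ℤ} → y ≤ x + c → y - x ≤ c
  y≤x+c⇒y-x≤c {x} {y} {c} y≤x+c = ≡.subst (y - x ≤_) (cancel x c) (+-monoˡ-≤ (- x) y≤x+c)
    where
    cancel : ∀ x c → x + c - x ≡ c
    cancel = solve-∀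

  ∣x-y∣≤c : ∀ (x y : ℤ) (c : ℕ) → x ≤ y + + c → y ≤ x + + c → ∣ x - y ∣ ℕ.≤ c
  ∣x-y∣≤c x y c x≤y+c y≤x+c with ≤-total x y
  ... | inj₁ x≤y = drop‿+≤+ (≡.subst (_≤ + c) (≡.sym (∣-∣-≤ x≤y)) (y≤x+c⇒y-x≤c y≤x+c))
  ... | inj₂ y≤x = ≡.subst (ℕ._≤ c) (∣i-j∣≡∣j-i∣ y x)
    (drop‿+≤+ (≡.subst (_≤ + c) (≡.sym (∣-∣-≤ y≤x)) (y≤x+c⇒y-x≤c x≤y+c)))

  small-close : ∀ (F F′ : ℤ) (Z Z′ Q : ℕ) → Q ℕ.* ∣ F ∣ ℕ.≤ Z → Q ℕ.* ∣ F′ ∣ ℕ.≤ Z′ →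
    Q ℕ.* ∣ + Z′ * F - + Z * F′ ∣ ℕ.≤ 2 ℕ.* Z ℕ.* Z′
  small-close F F′ Z Z′ Q Q∣F∣≤Z Q∣F′∣≤Z′ = begin
    Q ℕ.* ∣ + Z′ * F - + Z * F′ ∣                 ≤⟨ ℕP.*-monoʳ-≤ Q (∣i-j∣≤∣i∣+∣j∣ (+ Z′ * F) (+ Z * F′)) ⟩
    Q ℕ.* (∣ + Z′ * F ∣ ℕ.+ ∣ + Z * F′ ∣)         ≡⟨ cong (Q ℕ.*_) (cong₂ ℕ._+_ (abs-* (+ Z′) F) (abs-* (+ Z) F′)) ⟩
    Q ℕ.* (Z′ ℕ.* ∣ F ∣ ℕ.+ Z ℕ.* ∣ F′ ∣)         ≡⟨ distribute Q Z′ Z ∣ F ∣ ∣ F′ ∣ ⟩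
    Z′ ℕ.* (Q ℕ.* ∣ F ∣) ℕ.+ Z ℕ.* (Q ℕ.* ∣ F′ ∣) ≤⟨ ℕP.+-mono-≤ (ℕP.*-monoʳ-≤ Z′ Q∣F∣≤Z) (ℕP.*-monoʳ-≤ Z Q∣F′∣≤Z′) ⟩
    Z′ ℕ.* Z ℕ.+ Z ℕ.* Z′                         ≡⟨ double Z Z′ ⟩
    2 ℕ.* Z ℕ.* Z′                                ∎
    where
    open ℕP.≤-Reasoning
    distribute : ∀ Q Z′ Z a b → Q ℕ.* (Z′ ℕ.* a ℕ.+ Z ℕ.* b) ≡ Z′ ℕ.* (Q ℕ.* a) ℕ.+ Z ℕ.* (Q ℕ.* b)
    distribute = ℕRing.solve-∀
    double : ∀ Z Z′ → Z′ ℕ.* Z ℕ.+ Z ℕ.* Z′ ≡ 2 ℕ.* Z ℕ.* Z′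
    double = ℕRing.solve-∀

  same-bucket : ∀ {x x′ d d′} b → x ℕ.< suc b ℕ.* d → b ℕ.* d′ ℕ.≤ x′ → x ℕ.* d′ ℕ.≤ x′ ℕ.* d ℕ.+ d ℕ.* d′
  same-bucket {x} {x′} {d} {d′} b x<[b+1]d bd′≤x′ = begin
    x ℕ.* d′                     ≤⟨ ℕP.*-monoˡ-≤ d′ (ℕP.<⇒≤ x<[b+1]d) ⟩
    suc b ℕ.* d ℕ.* d′           ≡⟨ split b d d′ ⟩
    b ℕ.* d′ ℕ.* d ℕ.+ d ℕ.* d′  ≤⟨ ℕP.+-monoˡ-≤ (d ℕ.* d′) (ℕP.*-monoˡ-≤ d bd′≤x′) ⟩
    x′ ℕ.* d ℕ.+ d ℕ.* d′        ∎
    where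
    open ℕP.≤-Reasoning
    split : ∀ b d d′ → suc b ℕ.* d ℕ.* d′ ≡ b ℕ.* d′ ℕ.* d ℕ.+ d ℕ.* d′
    split = ℕRing.solve-∀

  -- u and u′ are F and F′ shifted to be non-negative; both u/Z and u′/Z′ lie in [2b/Q, 2(b+1)/Q).
  bucket-close : ∀ (F F′ : ℤ) (Z Z′ u u′ b Q : ℕ) → + u ≡ F + + Z → + u′ ≡ F′ + + Z′ →
    b ℕ.* (2 ℕ.* Z) ℕ.≤ u ℕ.* Q → u ℕ.* Q ℕ.< suc b ℕ.* (2 ℕ.* Z) →
    b ℕ.* (2 ℕ.* Z′) ℕ.≤ u′ ℕ.* Q → u′ ℕ.* Q ℕ.< suc b ℕ.* (2 ℕ.* Z′) →
    Q ℕ.* ∣ + Z′ * F - + Z * F′ ∣ ℕ.≤ 2 ℕ.* Z ℕ.* Z′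
  bucket-close F F′ Z Z′ u u′ b Q u≡ u′≡ lo hi lo′ hi′ = ℕP.*-cancelˡ-≤ 2 (begin
    2 ℕ.* (Q ℕ.* ∣ + Z′ * F - + Z * F′ ∣)   ≡⟨ ≡.trans (≡.sym (ℕP.*-assoc 2 Q _)) (≡.sym (abs-* (+ (2 ℕ.* Q)) _)) ⟩
    ∣ + (2 ℕ.* Q) * (+ Z′ * F - + Z * F′) ∣   ≡⟨ cong ∣_∣ (≡.sym gap≡) ⟩
    ∣ + X - + X′ ∣                            ≤⟨ ∣x-y∣≤c (+ X) (+ X′) C (≤+ X′ C (same-bucket b hi lo′))
                                                   (≤+ X C (≡.subst (X′ ℕ.≤_) (cong (X ℕ.+_) (ℕP.*-comm (2 ℕ.* Z′) (2 ℕ.* Z))) (same-bucket b hi′ lo))) ⟩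
    2 ℕ.* Z ℕ.* (2 ℕ.* Z′)                   ≡⟨ regroup Z Z′ ⟩
    2 ℕ.* (2 ℕ.* Z ℕ.* Z′)                   ∎)
    where
    open ℕP.≤-Reasoning
    X = u ℕ.* Q ℕ.* (2 ℕ.* Z′)
    X′ = u′ ℕ.* Q ℕ.* (2 ℕ.* Z)
    C = 2 ℕ.* Z ℕ.* (2 ℕ.* Z′)
    ≤+ : ∀ {m} n o → m ℕ.≤ n ℕ.+ o → + m ≤ + n + + o
    ≤+ {m} n o m≤n+o = ≡.subst (+ m ≤_) (pos-+ n o) (+≤+ m≤n+o)
    regroup : ∀ Z Z′ → 2 ℕ.* Z ℕ.* (2 ℕ.* Z′) ≡ 2 ℕ.* (2 ℕ.* Z ℕ.* Z′)
    regroup = ℕRing.solve-∀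
    +[abc] : ∀ a b c → + (a ℕ.* b ℕ.* c) ≡ + a * + b * + c
    +[abc] a b c = ≡.trans (pos-* (a ℕ.* b) c) (cong (_* + c) (pos-* a b))
    shift : ∀ F F′ Z Z′ Q → (F + Z) * Q * (+ 2 * Z′) - (F′ + Z′) * Q * (+ 2 * Z) ≡ + 2 * Q * (Z′ * F - Z * F′)
    shift = solve-∀
    gap≡ : + X - + X′ ≡ + (2 ℕ.* Q) * (+ Z′ * F - + Z * F′)
    gap≡ = ≡.trans (cong₂ _-_ (≡.trans (+[abc] u Q (2 ℕ.* Z′)) (cong₂ (λ w v → w * + Q * v) u≡ (pos-* 2 Z′)))
                              (≡.trans (+[abc] u′ Q (2 ℕ.* Z)) (cong₂ (λ w v → w * + Q * v) u′≡ (pos-* 2 Z))))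
           (≡.trans (shift F F′ (+ Z) (+ Z′) (+ Q)) (cong (_* (+ Z′ * F - + Z * F′)) (≡.sym (pos-* 2 Q))))

module Profile (n k Q : ℕ) where

  open import Data.Nat using (_+_; _*_; _^_; _≤_; _<_; NonZero; z≤n; s≤s)
  open import Data.Nat.Properties
  open import Data.Nat.DivMod using (_/_; _%_; m/n*n≤m; m≡m%n+[m/n]*n; m%n<n)
  import Data.Nat.Tactic.RingSolver as ℕRing
  open import Data.Integer as ℤ using (ℤ; +_; -[1+_]; 0ℤ; ∣_∣)
  import Data.Integer.Properties as ℤP
  open import Data.Fin.Subset using () renaming (∣_∣ to size)
  open import Data.List using (filter; cartesianProduct; upTo)
  open import Data.List.Properties using (length-map; length-upTo)
  open import Data.List.Membership.Propositional using (_∈_)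
  open import Data.List.Membership.Propositional.Properties
    using (∈-map⁺; ∈-map⁻; ∈-filter⁺; ∈-filter⁻; ∈-cartesianProduct⁺; ∈-upTo⁺)
  import Data.List.Relation.Unary.All as All
  open import Data.Product using (_×_; _,_; proj₁; proj₂)
  open import Data.Product.Properties using (,-injective)
  open import Relation.Nullary using (yes; no)
  open import Relation.Nullary.Decidable using (_×-dec_)
  open import Relation.Unary using (Decidable)
  open import Data.Empty using (⊥-elim)
  open ℕSum
  open SetCoefficients
  open Enumeration
  open Closeness using (small-close; bucket-close)
  open ≡ using (cong)

  Large : SubsetCube n → Cube n → Set
  Large A T = size T ≤ k × card A < Q * ∣ coeff A T ∣

  large? : ∀ A → Decidable (Large A)
  large? A T = size T ≤? k ×-dec card A <? Q * ∣ coeff A T ∣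

  largeCoeffs : SubsetCube n → List (Cube n)
  largeCoeffs A = filter (large? A) (cube n)

  length-largeCoeffs : ∀ A → .{{NonZero (card A)}} → length (largeCoeffs A) * card A ≤ Q * Q * 2 ^ n
  length-largeCoeffs A = *-cancelʳ-≤ _ _ (card A) (begin
    length (largeCoeffs A) * card A * card A       ≡⟨ *-assoc (length (largeCoeffs A)) (card A) (card A) ⟩
    length (largeCoeffs A) * (card A * card A)     ≤⟨ length-filter*≤∑ (large? A) f (card A * card A) card²≤f (cube n) ⟩
    ∑ f (cube n)                                   ≡⟨ ∑-cong (λ T → square Q ∣ coeff A T ∣) (cube n) ⟩
    ∑ (λ T → Q * Q * (∣ coeff A T ∣ * ∣ coeff A T ∣)) (cube n)
                                                   ≡⟨ ≡.sym (*-distribˡ-∑ (Q * Q) _ (cube n)) ⟩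
    Q * Q * ∑ (λ T → ∣ coeff A T ∣ * ∣ coeff A T ∣) (cube n)
                                                   ≡⟨ cong (Q * Q *_) (parseval A) ⟩
    Q * Q * (2 ^ n * card A)                       ≡⟨ ≡.sym (*-assoc (Q * Q) (2 ^ n) (card A)) ⟩
    Q * Q * 2 ^ n * card A                         ∎)
    where
    open ≤-Reasoning
    f : Cube n → ℕ
    f T = (Q * ∣ coeff A T ∣) * (Q * ∣ coeff A T ∣)
    card²≤f : ∀ T → Large A T → card A * card A ≤ f T
    card²≤f T (_ , lt) = *-mono-≤ (<⇒≤ lt) (<⇒≤ lt)
    square : ∀ Q c → (Q * c) * (Q * c) ≡ Q * Q * (c * c)
    square = ℕRing.solve-∀

  -- shifted and bucket place coeff A T / card A ∈ [-1, 1] in one of Q + 1 intervals of length 2 / Q.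
  shifted : SubsetCube n → Cube n → ℕ
  shifted A T = ∣ coeff A T ℤ.+ + card A ∣

  +shifted : ∀ A T → + shifted A T ≡ coeff A T ℤ.+ + card A
  +shifted A T = ℤP.0≤i⇒+∣i∣≡i (0≤i+c (coeff A T) (card A) (∣coeff∣≤card A T))
    where
    0≤i+c : ∀ i c → ∣ i ∣ ≤ c → 0ℤ ℤ.≤ i ℤ.+ + c
    0≤i+c (+ m) c _ = ℤ.+≤+ z≤n
    0≤i+c -[1+ m ] c m<c = ≡.subst (0ℤ ℤ.≤_) (≡.sym (ℤP.⊖-≥ m<c)) (ℤ.+≤+ z≤n)

  shifted≤2card : ∀ A T → shifted A T ≤ 2 * card A
  shifted≤2card A T = ≤-trans (ℤP.∣i+j∣≤∣i∣+∣j∣ (coeff A T) (+ card A))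
    (≤-trans (+-monoˡ-≤ (card A) (∣coeff∣≤card A T)) (≤-reflexive (cong (λ z → card A + z) (≡.sym (+-identityʳ (card A))))))

  module _ (A : SubsetCube n) .{{A≢∅ : NonZero (card A)}} where

    private instance
      2|A|≢0 : NonZero (2 * card A)
      2|A|≢0 = m*n≢0 2 (card A)

    bucket : Cube n → ℕ
    bucket T = (shifted A T * Q) / (2 * card A)

    bucket-lower : ∀ T → bucket T * (2 * card A) ≤ shifted A T * Q
    bucket-lower T = m/n*n≤m (shifted A T * Q) (2 * card A)

    bucket-upper : ∀ T → shifted A T * Q < suc (bucket T) * (2 * card A)
    bucket-upper T = begin-strict
      shifted A T * Q                                       ≡⟨ m≡m%n+[m/n]*n (shifted A T * Q) (2 * card A) ⟩
      (shifted A T * Q) % (2 * card A) + bucket T * (2 * card A)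
        <⟨ +-monoˡ-< (bucket T * (2 * card A)) (m%n<n (shifted A T * Q) (2 * card A)) ⟩
      suc (bucket T) * (2 * card A)                         ∎
      where open ≤-Reasoning

    bucket≤Q : ∀ T → bucket T ≤ Q
    bucket≤Q T = *-cancelʳ-≤ (bucket T) Q (2 * card A) (≤-trans (bucket-lower T)
      (≤-trans (*-monoˡ-≤ Q (shifted≤2card A T)) (≤-reflexive (*-comm (2 * card A) Q))))

    profile : List (Cube n × ℕ)
    profile = map (λ T → T , bucket T) (largeCoeffs A)

  entries : List (Cube n × ℕ)
  entries = cartesianProduct (subsetsUpTo n k) (upTo (suc Q))

  profile∈listsUpTo : ∀ A .{{_ : NonZero (card A)}} M → length (largeCoeffs A) ≤ M → profile A ∈ listsUpTo M entries
  profile∈listsUpTo A M |large|≤M =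
    ∈-listsUpTo M entries (All.tabulate entry∈) (≡.subst (_≤ M) (≡.sym (length-map _ (largeCoeffs A))) |large|≤M)
    where
    entry∈ : ∀ {e} → e ∈ profile A → e ∈ entries
    entry∈ e∈ with ∈-map⁻ (λ T → T , bucket A T) e∈
    ... | T , T∈ , ≡.refl = ∈-cartesianProduct⁺
      (∈-subsetsUpTo k T (proj₁ (proj₂ (∈-filter⁻ (large? A) {xs = cube n} T∈)))) (∈-upTo⁺ (s≤s (bucket≤Q A T)))

  length-listsUpTo-entries : 1 ≤ n → ∀ M → length (listsUpTo M entries) ≤ suc n ^ ((suc (suc Q) + k) * M)
  length-listsUpTo-entries 1≤n M = ≤-trans (length-listsUpTo M entries)
    (≤-trans (^-monoˡ-≤ M 1+|entries|≤) (≤-reflexive (^-*-assoc (suc n) (r + k) M)))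
    where
    open ≤-Reasoning
    r = suc (suc Q)
    m≤2^m : ∀ m → m ≤ 2 ^ m
    m≤2^m zero = z≤n
    m≤2^m (suc m) = +-mono-≤ (m^n>0 2 m) (≤-trans (m≤2^m m) (≤-reflexive (≡.sym (+-identityʳ (2 ^ m)))))
    1+|entries|≤ : suc (length entries) ≤ suc n ^ (r + k)
    1+|entries|≤ = begin
      suc (length entries)           ≡⟨ cong suc (≡.trans (length-cartesianProductWith _,_ (subsetsUpTo n k) (upTo (suc Q)))
                                                          (cong (length (subsetsUpTo n k) *_) (length-upTo (suc Q)))) ⟩
      suc (length (subsetsUpTo n k) * suc Q) ≤⟨ s≤s (*-monoˡ-≤ (suc Q) (length-subsetsUpTo n k)) ⟩
      suc (suc n ^ k * suc Q)        ≤⟨ +-monoˡ-≤ (suc n ^ k * suc Q) (m^n>0 (suc n) k) ⟩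
      suc n ^ k + suc n ^ k * suc Q  ≡⟨ ≡.sym (*-suc (suc n ^ k) (suc Q)) ⟩
      suc n ^ k * r                  ≤⟨ *-monoʳ-≤ (suc n ^ k) (≤-trans (m≤2^m r) (^-monoˡ-≤ r (s≤s 1≤n))) ⟩
      suc n ^ k * suc n ^ r          ≡⟨ ≡.trans (*-comm (suc n ^ k) _) (≡.sym (^-distribˡ-+-* (suc n) r k)) ⟩
      suc n ^ (r + k)                ∎

  large-transfer : ∀ A B .{{_ : NonZero (card A)}} .{{_ : NonZero (card B)}} → profile A ≡ profile B →
    ∀ {T} → Large A T → Large B T × bucket A T ≡ bucket B T
  large-transfer A B same {T} large with ∈-map⁻ (λ T → T , bucket B T)
    (≡.subst ((T , bucket A T) ∈_) same (∈-map⁺ (λ T → T , bucket A T) (∈-filter⁺ (large? A) (∈-cube T) large)))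
  ... | T′ , T′∈ , eq with ,-injective eq
  ... | ≡.refl , bucket≡ = proj₂ (∈-filter⁻ (large? B) {xs = cube n} T′∈) , bucket≡

  sameProfile⇒close : ∀ A B .{{_ : NonZero (card A)}} .{{_ : NonZero (card B)}} → profile A ≡ profile B →
    ∀ T → size T ≤ k → Q * coeffGap A B T ≤ 2 * card A * card B
  sameProfile⇒close A B same T |T|≤k with large? A T | large? B T
  ... | yes large | _ = bucket-close (coeff A T) (coeff B T) (card A) (card B) (shifted A T) (shifted B T) (bucket A T) Q
    (+shifted A T) (+shifted B T) (bucket-lower A T) (bucket-upper A T)
    (≡.subst (λ b → b * (2 * card B) ≤ shifted B T * Q) (≡.sym bucket≡) (bucket-lower B T))
    (≡.subst (λ b → shifted B T * Q < suc b * (2 * card B)) (≡.sym bucket≡) (bucket-upper B T))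
    where
    bucket≡ = proj₂ (large-transfer A B same large)
  ... | no small | yes large = ⊥-elim (small (proj₁ (large-transfer B A (≡.sym same) large)))
  ... | no smallA | no smallB = small-close (coeff A T) (coeff B T) (card A) (card B) Q (≮⇒≥ (smallA ∘ (|T|≤k ,_))) (≮⇒≥ (smallB ∘ (|T|≤k ,_)))

open import Data.Nat using (ℕ; suc; _^_; _≥_; _≤_; _*_)
open import Data.Fin using (Fin)
open import Data.Fin.Subset using (Subset; _∈_; ∣_∣)
open import Data.Product using (Σ; ∃; _×_; _,_)
open import Data.Rational using (ℚ; 0ℚ; _<_) renaming (_≤_ to _≤ℚ_; _*_ to _*ℚ_)

module Resolution (ν : ℚ) (ν>0 : 0ℚ < ν) (k : ℕ) where

  open import Data.Nat using (NonZero)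
  open import Data.Nat.Properties
  import Data.Nat.Tactic.RingSolver as ℕRing
  open import Data.Rational using (↧ₙ_)
  open import Data.Fin.Subset using (_⊆_)
  open import Data.Fin.Subset.Properties using (p⊆q⇒∣p∣≤∣q∣)
  import Data.List.Properties as List
  import Data.Product.Properties as Product
  import Data.Vec.Properties as Vec
  import Data.Bool as Bool
  open import Data.Product using (_,_; proj₁; proj₂)
  open SetCoefficients
  open Rationals using (p*b≤c⇒b≤c*↧p)
  open Enumeration using (listsUpTo)

  Q : ℕ
  Q = 2 * ↧ₙ ν * 2 ^ k

  instance
    Q≢0 : NonZero Q
    Q≢0 = m*n≢0 (2 * ↧ₙ ν) (2 ^ k) {{_}} {{m^n≢0 2 k}}

  module _ {n : ℕ} where

    open Profile n k Q

    sameProfile⇒TV≤ν : ∀ {m} A B .{{_ : NonZero (card A)}} .{{_ : NonZero (card B)}} → profile A ≡ profile B →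
      (g : Cube n → Fin m) → (∃ λ J → ∣ J ∣ ≤ k × DeterminedBy J g) → TV g A B ≤ℚ ν
    sameProfile⇒TV≤ν A B same g (J , |J|≤k , det) =
      TV≤ A B g ν ν>0 (*-cancelˡ-≤ (2 * 2 ^ k) {{m*n≢0 2 (2 ^ k) {{_}} {{m^n≢0 2 k}}}} (begin
        2 * 2 ^ k * (↧ₙ ν * fibreGap A B g)  ≡⟨ regroup (↧ₙ ν) (2 ^ k) (fibreGap A B g) ⟩
        Q * fibreGap A B g                   ≤⟨ *-fibreGap-≤ A B g det Q (2 * card A * card B) Q*gap≤ ⟩
        2 ^ ∣ J ∣ * (2 * card A * card B)    ≤⟨ *-monoˡ-≤ (2 * card A * card B) (^-monoʳ-≤ 2 |J|≤k) ⟩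
        2 ^ k * (2 * card A * card B)        ≡⟨ regroup′ (2 ^ k) (card A) (card B) ⟩
        2 * 2 ^ k * (card A * card B)        ∎))
      where
      open ≤-Reasoning
      Q*gap≤ : ∀ T → T ⊆ J → Q * coeffGap A B T ≤ 2 * card A * card B
      Q*gap≤ T T⊆J = sameProfile⇒close A B same T (≤-trans (p⊆q⇒∣p∣≤∣q∣ T⊆J) |J|≤k)
      regroup : ∀ K P g → 2 * P * (K * g) ≡ 2 * K * P * g
      regroup = ℕRing.solve-∀
      regroup′ : ∀ P a b → P * (2 * a * b) ≡ 2 * P * (a * b)
      regroup′ = ℕRing.solve-∀

    dense⇒few-large : ∀ δ → 0ℚ < δ → ∀ A .{{_ : NonZero (card A)}} → δ *ℚ toℚ (2 ^ n) ≤ℚ toℚ (card A) →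
      length (largeCoeffs A) ≤ Q * Q * ↧ₙ δ
    dense⇒few-large δ δ>0 A dense = *-cancelʳ-≤ _ _ (card A) (begin
      length (largeCoeffs A) * card A ≤⟨ length-largeCoeffs A ⟩
      Q * Q * 2 ^ n                   ≤⟨ *-monoʳ-≤ (Q * Q) (p*b≤c⇒b≤c*↧p δ δ>0 (2 ^ n) (card A) dense) ⟩
      Q * Q * (card A * ↧ₙ δ)         ≡⟨ regroup (Q * Q) (card A) (↧ₙ δ) ⟩
      Q * Q * ↧ₙ δ * card A           ∎)
      where
      open ≤-Reasoning
      regroup : ∀ q a d → q * (a * d) ≡ q * d * a
      regroup = ℕRing.solve-∀

    homogeneous-subfamily : ∀ M {s} (A : Fin s → SubsetCube n) (A≢∅ : ∀ i → NonZero (card (A i))) →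
      (∀ i → length (largeCoeffs (A i)) ≤ M) →
      Σ (Subset s) λ S → s ≤ ∣ S ∣ * length (listsUpTo M entries) ×
        (∀ i j → i ∈ S → j ∈ S → profile (A i) {{A≢∅ i}} ≡ profile (A j) {{A≢∅ j}})
    homogeneous-subfamily M A A≢∅ few = preimage f x , s≤ , λ i j i∈S j∈S →
      ≡.trans (∈-preimage⁻ f i i∈S) (≡.sym (∈-preimage⁻ f j j∈S))
      where
      open Pigeonhole (List.≡-dec (Product.≡-dec (Vec.≡-dec Bool._≟_) _≟_))
      f : Fin _ → List (Cube n × ℕ)
      f i = profile (A i) {{A≢∅ i}}
      pigeon = pigeonhole f (listsUpTo M entries) (λ i → profile∈listsUpTo (A i) {{A≢∅ i}} M (few i)) []
      x = proj₁ pigeon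
      s≤ = proj₂ pigeon

mainTheorem3 : (ν : ℚ) → 0ℚ < ν → (k : ℕ) → 1 ≤ k →
    ∃ λ (N : ℕ) → (δ : ℚ) → 0ℚ < δ →
    Σ ℕ λ (c : ℕ) → 1 ≤ c ×
      ((n : ℕ) → n ≥ N → (s : ℕ) → 1 ≤ s →
       (A : Fin s → SubsetCube n) →
       (∀ i → 1 ≤ card (A i)) →
       (∀ i → δ *ℚ toℚ (2 ^ n) ≤ℚ toℚ (card (A i))) →
       Σ (Subset s) λ S →
         (s ≤ ∣ S ∣ * (suc n ^ c)) ×
         ((m : ℕ) (g : Cube n → Fin m) →
          (∃ λ (J : Subset n) → ∣ J ∣ ≤ k × DeterminedBy J g) →
          ∀ i j → i ∈ S → j ∈ S → TV g (A i) (A j) ≤ℚ ν))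
-- The bound holds for k = 0 as well; N = 1 because counting profiles uses n ≥ 1.
mainTheorem3 ν ν>0 k _ = 1 , λ δ δ>0 → c δ , >-nonZero⁻¹ (c δ) {{c≢0 δ}} , λ n n≥1 s _ A A≢∅ dense →
  let nonZero i = >-nonZero (A≢∅ i)
      S , s≤ , same = homogeneous-subfamily (M δ) A nonZero (λ i → dense⇒few-large δ δ>0 (A i) {{nonZero i}} (dense i))
  in S , ≤-trans s≤ (*-monoʳ-≤ ∣ S ∣ (Profile.length-listsUpTo-entries n k Q n≥1 (M δ))) ,
     λ m g junta i j i∈S j∈S → sameProfile⇒TV≤ν (A i) (A j) {{nonZero i}} {{nonZero j}} (same i j i∈S j∈S) g junta
  where
  open Resolution ν ν>0 k
  open import Data.Nat using (_+_; NonZero; >-nonZero; >-nonZero⁻¹)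
  open import Data.Nat.Properties using (≤-trans; *-monoʳ-≤; m*n≢0)
  open import Data.Rational using (↧ₙ_)
  M : ℚ → ℕ
  M δ = Q * Q * ↧ₙ δ
  c : ℚ → ℕ
  c δ = (suc (suc Q) + k) * M δ
  c≢0 : ∀ δ → NonZero (c δ)
  c≢0 δ = m*n≢0 (suc (suc Q) + k) (M δ) {{_}} {{m*n≢0 (Q * Q) (↧ₙ δ) {{m*n≢0 Q Q}}}}
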